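{- Let $\mathfrak{p}\in\mathbb{F}_q[t]$ be monic irreducible of degree $d$, $k\ge1$ and $0\le l<k$. Then the $l$-th Hasse–Schmidt derivative with respect to $t$ of $\operatorname{O}^{(2)}_{\mathfrak{p}^k}(x,t)$ satisfies $$\delta^t_l\operatorname{O}^{(2)}_{\mathfrak{p}^k}(x,t)\equiv\mathfrak{p}(x)^{k-l-1}\operatorname{O}^{(2)}_{\mathfrak{p}}(x,t)^{l+1}\pmod{\mathfrak{p}(t)}$$ in $\mathbb{F}_q[x,t]$.
   Context: Let $\mathbb{F}_q$ be a finite field. For a monic $\mathfrak{g}(t)=b_mt^m+\cdots+b_0\in\mathbb{F}_q[t]$ of degree $m\ge1$, define $\operatorname{D}_{\mathfrak{g}}(x^i)=\sum_{j=0}^{m-i-1}b_{i+j+1}x^j$ and $\operatorname{O}^{(2)}_{\mathfrak{g}}(x,t)=\sum_{k=0}^{m-1}\operatorname{D}_{\mathfrak{g}}(x^k)t^k$. For a polynomial $F(x,t)$, the Hasse–Schmidt derivatives $\delta^t_lF$ are defined by $F(x,t+X)=\sum_{l\ge0}\delta^t_l(F)X^l$. -}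

module Defs where

open import Level using (Level; _⊔_)
open import Data.Nat using (ℕ; zero; suc; _∸_; _<_) renaming (_+_ to _+ℕ_)
open import Data.Fin using (Fin)
open import Data.List using (List; []; _∷_; map; length; upTo)
open import Data.Product using (Σ; ∃; _×_)
open import Data.Sum using (_⊎_)
open import Relation.Nullary using (¬_)
open import Algebra.Bundles using (CommutativeRing)
open import Algebra.Bundles.Raw using (RawRing)

record FiniteField (c ℓ : Level) : Set (Level.suc (c ⊔ ℓ)) where
  field
    commutativeRing : CommutativeRing c ℓ
  open CommutativeRing commutativeRing public
  field
    0≉1     : ¬ (0# ≈ 1#)
    inverse : ∀ x → ¬ (x ≈ 0#) → ∃ λ y → x * y ≈ 1#
    size    : ℕ
    enum    : Fin size → Carrier
    enum-surjective : ∀ x → ∃ λ i → enum i ≈ x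

-- Polynomials over a raw ring, as coefficient lists (lowest degree
-- first).  Equality is coefficientwise (so trailing zeros are
-- irrelevant).  Iterating gives multivariate polynomial rings.

module _ {c ℓ : Level} (R : RawRing c ℓ) where
  open RawRing R

  coeff : List Carrier → ℕ → Carrier
  coeff []       _       = 0#
  coeff (a ∷ f)  zero    = a
  coeff (a ∷ f)  (suc i) = coeff f i

  private
    add : List Carrier → List Carrier → List Carrier
    add []      g       = g
    add (a ∷ f) []      = a ∷ f
    add (a ∷ f) (b ∷ g) = (a + b) ∷ add f g

    mul : List Carrier → List Carrier → List Carrier
    mul []      g = []
    mul (a ∷ f) g = add (map (a *_) g) (0# ∷ mul f g)

  Poly : RawRing c ℓ
  Poly = record
    { Carrier = List Carrier
    ; _≈_     = λ f g → ∀ i → coeff f i ≈ coeff g i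
    ; _+_     = add
    ; _*_     = mul
    ; -_      = map -_
    ; 0#      = []
    ; 1#      = 1# ∷ []
    }

  const : Carrier → List Carrier
  const a = a ∷ []

  var : List Carrier
  var = 0# ∷ 1# ∷ []

module _ {c ℓ : Level} (R : RawRing c ℓ) where
  open RawRing R

  pow : Carrier → ℕ → Carrier
  pow a zero    = 1#
  pow a (suc n) = a * pow a n

  IsUnit : Carrier → Set (c ⊔ ℓ)
  IsUnit u = ∃ λ v → u * v ≈ 1#

  Irreducible : Carrier → Set (c ⊔ ℓ)
  Irreducible p = ¬ IsUnit p × (∀ a b → p ≈ a * b → IsUnit a ⊎ IsUnit b)

-- Definitions over a raw ring R:  F[x] = Poly R,
-- F[x,t] = Poly (Poly R)  (outer variable t, coefficients in F[x]),
-- F[x,t][X] = Poly (Poly (Poly R)) (outermost variable X).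

module Constructions {c ℓ : Level} (R : RawRing c ℓ) where
  open RawRing R

  Rx : RawRing c ℓ
  Rx = Poly R

  Rxt : RawRing c ℓ
  Rxt = Poly Rx

  RxtX : RawRing c ℓ
  RxtX = Poly Rxt

  MonicOfDegree : RawRing.Carrier Rx → ℕ → Set ℓ
  MonicOfDegree g d = (coeff R g d ≈ 1#) × (∀ i → d < i → coeff R g i ≈ 0#)

  -- the formal degree m of a coefficient list (length - 1); for a list
  -- without trailing zeros this is the degree, otherwise only extra zero
  -- terms appear in the sums below.
  fdeg : RawRing.Carrier Rx → ℕ
  fdeg g = length g ∸ 1

  -- D_g(x^i) = Σ_{j=0}^{m-i-1} b_{i+j+1} x^j   (element of F[x])
  D : RawRing.Carrier Rx → ℕ → RawRing.Carrier Rx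
  D g i = map (λ j → coeff R g (i +ℕ j +ℕ 1)) (upTo (fdeg g ∸ i))

  -- O^(2)_g(x,t) = Σ_{k=0}^{m-1} D_g(x^k) t^k   (element of F[x,t]):
  -- the polynomial in t whose t^k coefficient is D_g(x^k)
  O2 : RawRing.Carrier Rx → RawRing.Carrier Rxt
  O2 g = map (D g) (upTo (fdeg g))

  -- embeddings F[x] → F[x,t]:  g ↦ g(x)  and  g ↦ g(t)
  inX : RawRing.Carrier Rx → RawRing.Carrier Rxt
  inX g = const Rx g

  inT : RawRing.Carrier Rx → RawRing.Carrier Rxt
  inT g = map (const R) g

  -- F(x, t + X) ∈ F[x,t][X], by Horner evaluation of F at t + X
  shift : RawRing.Carrier Rxt → RawRing.Carrier RxtX
  shift []      = RawRing.0# RxtX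
  shift (a ∷ f) = RawRing._+_ RxtX (const Rxt (const Rx a))
                    (RawRing._*_ RxtX tPlusX (shift f))
    where
    -- t + X  =  t·X⁰ + 1·X¹
    tPlusX : RawRing.Carrier RxtX
    tPlusX = var Rx ∷ RawRing.1# Rxt ∷ []

  -- Hasse–Schmidt derivative: F(x,t+X) = Σ_l δ^t_l(F) X^l
  δt : ℕ → RawRing.Carrier Rxt → RawRing.Carrier Rxt
  δt l F = coeff Rxt (shift F) l

  _≡_mod_ : RawRing.Carrier Rxt → RawRing.Carrier Rxt → RawRing.Carrier Rxt → Set (c ⊔ ℓ)
  A ≡ B mod h = ∃ λ H → RawRing._≈_ Rxt A (RawRing._+_ Rxt B (RawRing._*_ Rxt h H))

{-# OPTIONS --safe #-}
module Submission where

-- Write u = x − t, π = 𝔭(t), p = 𝔭(x) and G = O2(𝔭ᵏ).  Since O2(g) is the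
-- divided difference (g(x) − g(t)) / (x − t), we have u G + πᵏ = pᵏ and
-- u O2(𝔭) + π = p.  Substituting t ↦ t + X turns u into u − X, and
-- 𝔭(t + X)ᵏ ≡ Xᵏ Vᵏ (mod π) for some V; so comparing coefficients of X^l, with
-- S_l = δ^t_l G, gives u S₀ ≡ pᵏ and u S_(l+1) ≡ S_l (mod π) for l + 1 < k.
-- Finally u can be cancelled modulo π, because π(t := x) = p is a
-- non-zero-divisor; induction on l then gives S_l ≡ p^(k−l−1) O2(𝔭)^(l+1).

open import Defs
open import Level using (Level; _⊔_)
open import Data.Nat using (ℕ; zero; suc; _≤_; _<_; z≤n; s≤s; _∸_) renaming (_+_ to _+ℕ_)
import Data.Nat.Properties as ℕ
open import Data.List using (List; []; _∷_; map; length; drop; applyUpTo; upTo)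
open import Data.List.Properties using (map-upTo)
open import Data.Product using (Σ; _,_; proj₁; proj₂)
open import Function using (_∘_)
open import Relation.Binary.PropositionalEquality as ≡ using (_≡_)
open import Relation.Binary.Structures using (IsEquivalence)
open import Relation.Binary.Bundles using (Setoid)
import Relation.Binary.Reasoning.Setoid as ≈-Reasoning
open import Algebra.Bundles using (CommutativeRing; AbelianGroup)
open import Algebra.Bundles.Raw using (RawRing)
open import Algebra.Structures using (IsCommutativeRing; IsAbelianGroup)
open import Algebra.Morphism.Structures using (IsRingHomomorphism; module IsRingHomomorphism)
import Algebra.Morphism.Construct.Identity as Identity
import Algebra.Morphism.Construct.Composition as Composition

coeff-beyond : ∀ {c ℓ} (R : RawRing c ℓ) f {n} → length f ≤ n → coeff R f n ≡ RawRing.0# R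
coeff-beyond R []      _        = ≡.refl
coeff-beyond R (a ∷ f) (s≤s le) = coeff-beyond R f le

coeff-applyUpTo : ∀ {c ℓ} (R : RawRing c ℓ) (h : ℕ → RawRing.Carrier R) n →
                  (∀ j → n ≤ j → h j ≡ RawRing.0# R) → ∀ i → coeff R (applyUpTo h n) i ≡ h i
coeff-applyUpTo R h zero    h≡0 i       = ≡.sym (h≡0 i z≤n)
coeff-applyUpTo R h (suc n) h≡0 zero    = ≡.refl
coeff-applyUpTo R h (suc n) h≡0 (suc i) =
  coeff-applyUpTo R (h ∘ suc) n (λ j n≤j → h≡0 (suc j) (s≤s n≤j)) i

module _ {c ℓ : Level} (A : CommutativeRing c ℓ) where
  open CommutativeRing A

  NonZeroDivisor : Carrier → Set (c ⊔ ℓ)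
  NonZeroDivisor a = ∀ z → a * z ≈ 0# → z ≈ 0#

  pow-cong : ∀ {a b} → a ≈ b → ∀ n → pow rawRing a n ≈ pow rawRing b n
  pow-cong a≈b zero    = refl
  pow-cong a≈b (suc n) = *-cong a≈b (pow-cong a≈b n)

module _ {c₁ ℓ₁ c₂ ℓ₂ : Level} (S : CommutativeRing c₁ ℓ₁) (T : CommutativeRing c₂ ℓ₂) where
  private
    module S = CommutativeRing S
    module T = CommutativeRing T

  mkIsRingHomomorphism : ∀ {φ : S.Carrier → T.Carrier} →
    (∀ {a b} → a S.≈ b → φ a T.≈ φ b) →
    (∀ a b → φ (a S.+ b) T.≈ φ a T.+ φ b) →
    (∀ a b → φ (a S.* b) T.≈ φ a T.* φ b) →
    φ S.0# T.≈ T.0# → φ S.1# T.≈ T.1# →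
    (∀ a → φ (S.- a) T.≈ T.- φ a) →
    IsRingHomomorphism S.rawRing T.rawRing φ
  mkIsRingHomomorphism cong +-homo *-homo 0#-homo 1#-homo -‿homo = record
    { isSemiringHomomorphism = record
      { isNearSemiringHomomorphism = record
        { +-isMonoidHomomorphism = record
          { isMagmaHomomorphism = record
            { isRelHomomorphism = record { cong = cong }
            ; homo = +-homo }
          ; ε-homo = 0#-homo }
        ; *-homo = *-homo }
      ; 1#-homo = 1#-homo }
    ; -‿homo = -‿homo }

  pow-homo : ∀ {φ} → IsRingHomomorphism S.rawRing T.rawRing φ →
             ∀ a n → φ (pow S.rawRing a n) T.≈ pow T.rawRing (φ a) n
  pow-homo φ-hom a zero    = IsRingHomomorphism.1#-homo φ-hom
  pow-homo φ-hom a (suc n) =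
    T.trans (IsRingHomomorphism.*-homo φ-hom a _) (T.*-congˡ (pow-homo φ-hom a n))

module Congruence {c ℓ : Level} (A : CommutativeRing c ℓ) where
  open CommutativeRing A
  open import Algebra.Solver.Ring.NaturalCoefficients.Default commutativeSemiring
  open ≈-Reasoning setoid

  infix 4 _≈_mod_
  _≈_mod_ : Carrier → Carrier → Carrier → Set (c ⊔ ℓ)
  _≈_mod_ y z m = Σ Carrier λ h → y ≈ z + m * h

  ≈⇒≈mod : ∀ {y z m} → y ≈ z → y ≈ z mod m
  ≈⇒≈mod {m = m} y≈z = 0# , trans y≈z (sym (trans (+-congˡ (zeroʳ m)) (+-identityʳ _)))

  ≈mod-trans : ∀ {x y z m} → x ≈ y mod m → y ≈ z mod m → x ≈ z mod m
  ≈mod-trans {x} {y} {z} {m} (h , x≈) (h′ , y≈) = h′ + h , (begin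
    x                   ≈⟨ x≈ ⟩
    y + m * h           ≈⟨ +-congʳ y≈ ⟩
    (z + m * h′) + m * h ≈⟨ solve 4 (λ z m h h′ → (z :+ m :* h′) :+ m :* h := z :+ m :* (h′ :+ h))
                                    refl z m h h′ ⟩
    z + m * (h′ + h)    ∎)

  +*≈⇒≈mod : ∀ {y z m h} → y + m * h ≈ z → y ≈ z mod m
  +*≈⇒≈mod {y} {z} {m} {h} y+mh≈z = - h , (begin
    y                         ≈⟨ sym (+-identityʳ y) ⟩
    y + 0#                    ≈⟨ +-congˡ (sym (trans (sym (distribˡ m h (- h)))
                                                     (trans (*-congˡ (-‿inverseʳ h)) (zeroʳ m)))) ⟩
    y + (m * h + m * - h)     ≈⟨ sym (+-assoc y _ _) ⟩
    (y + m * h) + m * - h     ≈⟨ +-congʳ y+mh≈z ⟩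
    z + m * - h               ∎)

  pow-+*-≈mod : ∀ m a b n → pow rawRing (m + a * b) n ≈ pow rawRing a n * pow rawRing b n mod m
  pow-+*-≈mod m a b zero    = ≈⇒≈mod (sym (*-identityʳ 1#))
  pow-+*-≈mod m a b (suc n) with pow-+*-≈mod m a b n
  ... | h , eq = aⁿbⁿ + (m + a * b) * h , (begin
    (m + a * b) * pow rawRing (m + a * b) n ≈⟨ *-congˡ eq ⟩
    (m + a * b) * (aⁿbⁿ + m * h)            ≈⟨ solve 6 (λ m a b aⁿ bⁿ h →
                                                 (m :+ a :* b) :* (aⁿ :* bⁿ :+ m :* h)
                                                 := (a :* aⁿ) :* (b :* bⁿ) :+ m :* (aⁿ :* bⁿ :+ (m :+ a :* b) :* h))
                                                 refl m a b (pow rawRing a n) (pow rawRing b n) h ⟩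
    (a * pow rawRing a n) * (b * pow rawRing b n) + m * (aⁿbⁿ + (m + a * b) * h) ∎)
    where aⁿbⁿ = pow rawRing a n * pow rawRing b n

module Polynomials {c ℓ : Level} (R : CommutativeRing c ℓ) where
  open CommutativeRing R hiding (zero)

  Pol : Set c
  Pol = List Carrier

  open RawRing (Poly rawRing) public
    using () renaming (_+_ to _⊕_; _*_ to _⊛_; -_ to ⊝_; _≈_ to _≈ₚ_)

  coef : Pol → ℕ → Carrier
  coef = coeff rawRing

  cst : Carrier → Pol
  cst = const rawRing

  X : Pol
  X = var rawRing

  scale : Carrier → Pol → Pol
  scale a = map (a *_)

  -- A record wrapper around _≈ₚ_, so that Agda can infer the polynomials
  -- from a proof of their equality.
  infix 4 _≋_
  record _≋_ (f g : Pol) : Set ℓ where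
    constructor mk≋
    field coef-≈ : f ≈ₚ g
  open _≋_ public

  ≋-refl : ∀ {f} → f ≋ f
  ≋-refl = mk≋ λ _ → refl

  ≋-sym : ∀ {f g} → f ≋ g → g ≋ f
  ≋-sym (mk≋ p) = mk≋ λ i → sym (p i)

  ≋-trans : ∀ {f g h} → f ≋ g → g ≋ h → f ≋ h
  ≋-trans (mk≋ p) (mk≋ q) = mk≋ λ i → trans (p i) (q i)

  ≡⇒≋ : ∀ {f g} → f ≡ g → f ≋ g
  ≡⇒≋ ≡.refl = ≋-refl

  ≋-isEquivalence : IsEquivalence _≋_
  ≋-isEquivalence = record { refl = ≋-refl ; sym = ≋-sym ; trans = ≋-trans }

  ≋-setoid : Setoid c ℓ
  ≋-setoid = record { isEquivalence = ≋-isEquivalence }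

  module ≋-Reasoning = ≈-Reasoning ≋-setoid

  coef-⊕ : ∀ f g i → coef (f ⊕ g) i ≈ coef f i + coef g i
  coef-⊕ []      g       i       = sym (+-identityˡ _)
  coef-⊕ (a ∷ f) []      i       = sym (+-identityʳ _)
  coef-⊕ (a ∷ f) (b ∷ g) zero    = refl
  coef-⊕ (a ∷ f) (b ∷ g) (suc i) = coef-⊕ f g i

  coef-⊝ : ∀ f i → coef (⊝ f) i ≈ - coef f i
  coef-⊝ []      i       = sym (-0#≈0#) where open import Algebra.Properties.Ring ring using (-0#≈0#)
  coef-⊝ (a ∷ f) zero    = refl
  coef-⊝ (a ∷ f) (suc i) = coef-⊝ f i

  coef-scale : ∀ a f i → coef (scale a f) i ≈ a * coef f i
  coef-scale a []      i       = sym (zeroʳ a)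
  coef-scale a (b ∷ f) zero    = refl
  coef-scale a (b ∷ f) (suc i) = coef-scale a f i

  ∷-cong : ∀ {a b f g} → a ≈ b → f ≋ g → a ∷ f ≋ b ∷ g
  ∷-cong a≈b (mk≋ p) = mk≋ λ { zero → a≈b ; (suc i) → p i }

  ∷-injectiveʳ : ∀ {a b f g} → a ∷ f ≋ b ∷ g → f ≋ g
  ∷-injectiveʳ (mk≋ p) = mk≋ (p ∘ suc)

  ⊕-cong : ∀ {f f′ g g′} → f ≋ f′ → g ≋ g′ → f ⊕ g ≋ f′ ⊕ g′
  ⊕-cong {f} {f′} {g} {g′} (mk≋ p) (mk≋ q) = mk≋ λ i →
    trans (coef-⊕ f g i) (trans (+-cong (p i) (q i)) (sym (coef-⊕ f′ g′ i)))

  ⊝-cong : ∀ {f f′} → f ≋ f′ → ⊝ f ≋ ⊝ f′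
  ⊝-cong {f} {f′} (mk≋ p) = mk≋ λ i →
    trans (coef-⊝ f i) (trans (-‿cong (p i)) (sym (coef-⊝ f′ i)))

  scale-cong : ∀ {a b f g} → a ≈ b → f ≋ g → scale a f ≋ scale b g
  scale-cong {a} {b} {f} {g} a≈b (mk≋ p) = mk≋ λ i →
    trans (coef-scale a f i) (trans (*-cong a≈b (p i)) (sym (coef-scale b g i)))

  ⊕-assoc : ∀ f g h → (f ⊕ g) ⊕ h ≋ f ⊕ (g ⊕ h)
  ⊕-assoc f g h = mk≋ λ i → begin
    coef ((f ⊕ g) ⊕ h) i         ≈⟨ coef-⊕ (f ⊕ g) h i ⟩
    coef (f ⊕ g) i + coef h i    ≈⟨ +-congʳ (coef-⊕ f g i) ⟩
    (coef f i + coef g i) + coef h i ≈⟨ +-assoc _ _ _ ⟩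
    coef f i + (coef g i + coef h i) ≈⟨ +-congˡ (coef-⊕ g h i) ⟨
    coef f i + coef (g ⊕ h) i    ≈⟨ coef-⊕ f (g ⊕ h) i ⟨
    coef (f ⊕ (g ⊕ h)) i         ∎
    where open ≈-Reasoning setoid

  ⊕-comm : ∀ f g → f ⊕ g ≋ g ⊕ f
  ⊕-comm f g = mk≋ λ i → trans (coef-⊕ f g i) (trans (+-comm _ _) (sym (coef-⊕ g f i)))

  ⊕-identityˡ : ∀ f → [] ⊕ f ≋ f
  ⊕-identityˡ f = ≋-refl

  ⊕-identityʳ : ∀ f → f ⊕ [] ≋ f
  ⊕-identityʳ f = mk≋ λ i → trans (coef-⊕ f [] i) (+-identityʳ _)

  ⊝-inverseˡ : ∀ f → (⊝ f) ⊕ f ≋ []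
  ⊝-inverseˡ f = mk≋ λ i → trans (coef-⊕ (⊝ f) f i) (trans (+-congʳ (coef-⊝ f i)) (-‿inverseˡ _))

  ⊝-inverseʳ : ∀ f → f ⊕ (⊝ f) ≋ []
  ⊝-inverseʳ f = mk≋ λ i → trans (coef-⊕ f (⊝ f) i) (trans (+-congˡ (coef-⊝ f i)) (-‿inverseʳ _))

  ⊕-isAbelianGroup : IsAbelianGroup _≋_ _⊕_ [] ⊝_
  ⊕-isAbelianGroup = record
    { isGroup = record
      { isMonoid = record
        { isSemigroup = record
          { isMagma = record { isEquivalence = ≋-isEquivalence ; ∙-cong = ⊕-cong }
          ; assoc = ⊕-assoc }
        ; identity = ⊕-identityˡ , ⊕-identityʳ }
      ; inverse = ⊝-inverseˡ , ⊝-inverseʳ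
      ; ⁻¹-cong = ⊝-cong }
    ; comm = ⊕-comm }

  ⊕-abelianGroup : AbelianGroup c ℓ
  ⊕-abelianGroup = record { isAbelianGroup = ⊕-isAbelianGroup }

  open import Algebra.Properties.CommutativeSemigroup (AbelianGroup.commutativeSemigroup ⊕-abelianGroup)
    using (interchange; x∙yz≈y∙xz)

  scale-⊕ : ∀ a f g → scale a (f ⊕ g) ≋ scale a f ⊕ scale a g
  scale-⊕ a f g = mk≋ λ i → begin
    coef (scale a (f ⊕ g)) i               ≈⟨ coef-scale a (f ⊕ g) i ⟩
    a * coef (f ⊕ g) i                     ≈⟨ *-congˡ (coef-⊕ f g i) ⟩
    a * (coef f i + coef g i)              ≈⟨ distribˡ _ _ _ ⟩
    a * coef f i + a * coef g i            ≈⟨ +-cong (coef-scale a f i) (coef-scale a g i) ⟨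
    coef (scale a f) i + coef (scale a g) i ≈⟨ coef-⊕ (scale a f) (scale a g) i ⟨
    coef (scale a f ⊕ scale a g) i         ∎
    where open ≈-Reasoning setoid

  scale-+ : ∀ a b f → scale (a + b) f ≋ scale a f ⊕ scale b f
  scale-+ a b f = mk≋ λ i → begin
    coef (scale (a + b) f) i               ≈⟨ coef-scale (a + b) f i ⟩
    (a + b) * coef f i                     ≈⟨ distribʳ _ _ _ ⟩
    a * coef f i + b * coef f i            ≈⟨ +-cong (coef-scale a f i) (coef-scale b f i) ⟨
    coef (scale a f) i + coef (scale b f) i ≈⟨ coef-⊕ (scale a f) (scale b f) i ⟨
    coef (scale a f ⊕ scale b f) i         ∎
    where open ≈-Reasoning setoid

  scale-scale : ∀ a b f → scale a (scale b f) ≋ scale (a * b) f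
  scale-scale a b f = mk≋ λ i → begin
    coef (scale a (scale b f)) i ≈⟨ coef-scale a (scale b f) i ⟩
    a * coef (scale b f) i       ≈⟨ *-congˡ (coef-scale b f i) ⟩
    a * (b * coef f i)           ≈⟨ *-assoc _ _ _ ⟨
    (a * b) * coef f i           ≈⟨ coef-scale (a * b) f i ⟨
    coef (scale (a * b) f) i     ∎
    where open ≈-Reasoning setoid

  scale-1# : ∀ f → scale 1# f ≋ f
  scale-1# f = mk≋ λ i → trans (coef-scale 1# f i) (*-identityˡ _)

  scale-0# : ∀ f → scale 0# f ≋ []
  scale-0# f = mk≋ λ i → trans (coef-scale 0# f i) (zeroˡ _)

  0∷[]≋[] : 0# ∷ [] ≋ []
  0∷[]≋[] = mk≋ λ { zero → refl ; (suc i) → refl }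

  0∷-⊕ : ∀ f g → 0# ∷ (f ⊕ g) ≋ (0# ∷ f) ⊕ (0# ∷ g)
  0∷-⊕ f g = ∷-cong (sym (+-identityˡ 0#)) ≋-refl

  ⊛-zeroˡ : ∀ {f} g → f ≋ [] → f ⊛ g ≋ []
  ⊛-zeroˡ {[]}    g f≋0 = ≋-refl
  ⊛-zeroˡ {a ∷ f} g f≋0 = begin
    scale a g ⊕ (0# ∷ (f ⊛ g)) ≈⟨ ⊕-cong (scale-cong (coef-≈ f≋0 0) ≋-refl)
                                         (∷-cong refl (⊛-zeroˡ {f} g (mk≋ (coef-≈ f≋0 ∘ suc)))) ⟩
    scale 0# g ⊕ (0# ∷ [])     ≈⟨ ⊕-cong (scale-0# g) 0∷[]≋[] ⟩
    []                         ∎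
    where open ≋-Reasoning

  ⊛-congˡ : ∀ {f f′} g → f ≋ f′ → f ⊛ g ≋ f′ ⊛ g
  ⊛-congˡ {[]}    {[]}     g p = ≋-refl
  ⊛-congˡ {[]}    {b ∷ f′} g p = ≋-sym (⊛-zeroˡ {b ∷ f′} g (≋-sym p))
  ⊛-congˡ {a ∷ f} {[]}     g p = ⊛-zeroˡ {a ∷ f} g p
  ⊛-congˡ {a ∷ f} {b ∷ f′} g p =
    ⊕-cong (scale-cong (coef-≈ p 0) ≋-refl) (∷-cong refl (⊛-congˡ {f} {f′} g (∷-injectiveʳ p)))

  ⊛-congʳ : ∀ f {g g′} → g ≋ g′ → f ⊛ g ≋ f ⊛ g′
  ⊛-congʳ []      p = ≋-refl
  ⊛-congʳ (a ∷ f) p = ⊕-cong (scale-cong refl p) (∷-cong refl (⊛-congʳ f p))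

  ⊛-cong : ∀ {f f′ g g′} → f ≋ f′ → g ≋ g′ → f ⊛ g ≋ f′ ⊛ g′
  ⊛-cong {f} {f′} {g} p q = ≋-trans (⊛-congˡ g p) (⊛-congʳ f′ q)

  ⊛-distribʳ : ∀ h f g → (f ⊕ g) ⊛ h ≋ (f ⊛ h) ⊕ (g ⊛ h)
  ⊛-distribʳ h []      g       = ≋-refl
  ⊛-distribʳ h (a ∷ f) []      = ≋-sym (⊕-identityʳ _)
  ⊛-distribʳ h (a ∷ f) (b ∷ g) = begin
    scale (a + b) h ⊕ (0# ∷ ((f ⊕ g) ⊛ h))
      ≈⟨ ⊕-cong (scale-+ a b h) (≋-trans (∷-cong refl (⊛-distribʳ h f g)) (0∷-⊕ (f ⊛ h) (g ⊛ h))) ⟩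
    (scale a h ⊕ scale b h) ⊕ ((0# ∷ (f ⊛ h)) ⊕ (0# ∷ (g ⊛ h)))
      ≈⟨ interchange (scale a h) (scale b h) (0# ∷ (f ⊛ h)) (0# ∷ (g ⊛ h)) ⟩
    (scale a h ⊕ (0# ∷ (f ⊛ h))) ⊕ (scale b h ⊕ (0# ∷ (g ⊛ h))) ∎
    where open ≋-Reasoning

  ⊛-distribˡ : ∀ f g h → f ⊛ (g ⊕ h) ≋ (f ⊛ g) ⊕ (f ⊛ h)
  ⊛-distribˡ []      g h = ≋-refl
  ⊛-distribˡ (a ∷ f) g h = begin
    scale a (g ⊕ h) ⊕ (0# ∷ (f ⊛ (g ⊕ h)))
      ≈⟨ ⊕-cong (scale-⊕ a g h) (≋-trans (∷-cong refl (⊛-distribˡ f g h)) (0∷-⊕ (f ⊛ g) (f ⊛ h))) ⟩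
    (scale a g ⊕ scale a h) ⊕ ((0# ∷ (f ⊛ g)) ⊕ (0# ∷ (f ⊛ h)))
      ≈⟨ interchange (scale a g) (scale a h) (0# ∷ (f ⊛ g)) (0# ∷ (f ⊛ h)) ⟩
    (scale a g ⊕ (0# ∷ (f ⊛ g))) ⊕ (scale a h ⊕ (0# ∷ (f ⊛ h))) ∎
    where open ≋-Reasoning

  0∷-⊛ : ∀ f g → (0# ∷ f) ⊛ g ≋ 0# ∷ (f ⊛ g)
  0∷-⊛ f g = ≋-trans (⊕-cong (scale-0# g) ≋-refl) (⊕-identityˡ _)

  scale-⊛ : ∀ a f g → scale a (f ⊛ g) ≋ scale a f ⊛ g
  scale-⊛ a []      g = ≋-refl
  scale-⊛ a (b ∷ f) g = begin
    scale a (scale b g ⊕ (0# ∷ (f ⊛ g)))          ≈⟨ scale-⊕ a (scale b g) (0# ∷ (f ⊛ g)) ⟩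
    scale a (scale b g) ⊕ ((a * 0#) ∷ scale a (f ⊛ g)) ≈⟨ ⊕-cong (scale-scale a b g) (∷-cong (zeroʳ a) (scale-⊛ a f g)) ⟩
    scale (a * b) g ⊕ (0# ∷ (scale a f ⊛ g))      ∎
    where open ≋-Reasoning

  ⊛-assoc : ∀ f g h → (f ⊛ g) ⊛ h ≋ f ⊛ (g ⊛ h)
  ⊛-assoc []      g h = ≋-refl
  ⊛-assoc (a ∷ f) g h = begin
    (scale a g ⊕ (0# ∷ (f ⊛ g))) ⊛ h         ≈⟨ ⊛-distribʳ h (scale a g) _ ⟩
    (scale a g ⊛ h) ⊕ ((0# ∷ (f ⊛ g)) ⊛ h)   ≈⟨ ⊕-cong (≋-sym (scale-⊛ a g h))
                                                       (≋-trans (0∷-⊛ (f ⊛ g) h) (∷-cong refl (⊛-assoc f g h))) ⟩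
    scale a (g ⊛ h) ⊕ (0# ∷ (f ⊛ (g ⊛ h)))   ∎
    where open ≋-Reasoning

  ⊛-zeroʳ : ∀ f → f ⊛ [] ≋ []
  ⊛-zeroʳ []      = ≋-refl
  ⊛-zeroʳ (a ∷ f) = ≋-trans (∷-cong refl (⊛-zeroʳ f)) 0∷[]≋[]

  ⊛-∷ : ∀ f b g → f ⊛ (b ∷ g) ≋ scale b f ⊕ (0# ∷ (f ⊛ g))
  ⊛-∷ []      b g = ≋-sym 0∷[]≋[]
  ⊛-∷ (a ∷ f) b g = ∷-cong (+-congʳ (*-comm a b)) (begin
    scale a g ⊕ (f ⊛ (b ∷ g))                   ≈⟨ ⊕-cong ≋-refl (⊛-∷ f b g) ⟩
    scale a g ⊕ (scale b f ⊕ (0# ∷ (f ⊛ g)))    ≈⟨ x∙yz≈y∙xz (scale a g) (scale b f) (0# ∷ (f ⊛ g)) ⟩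
    scale b f ⊕ (scale a g ⊕ (0# ∷ (f ⊛ g)))    ∎)
    where open ≋-Reasoning

  ⊛-comm : ∀ f g → f ⊛ g ≋ g ⊛ f
  ⊛-comm []      g = ≋-sym (⊛-zeroʳ g)
  ⊛-comm (a ∷ f) g = ≋-trans (⊕-cong ≋-refl (∷-cong refl (⊛-comm f g))) (≋-sym (⊛-∷ g a f))

  ⊛-identityˡ : ∀ f → (1# ∷ []) ⊛ f ≋ f
  ⊛-identityˡ f = ≋-trans (⊕-cong (scale-1# f) 0∷[]≋[]) (⊕-identityʳ f)

  ⊛-identityʳ : ∀ f → f ⊛ (1# ∷ []) ≋ f
  ⊛-identityʳ f = ≋-trans (⊛-comm f _) (⊛-identityˡ f)

  ≋-isCommutativeRing : IsCommutativeRing _≋_ _⊕_ _⊛_ ⊝_ [] (1# ∷ [])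
  ≋-isCommutativeRing = record
    { isRing = record
      { +-isAbelianGroup = ⊕-isAbelianGroup
      ; *-cong = ⊛-cong
      ; *-assoc = ⊛-assoc
      ; *-identity = ⊛-identityˡ , ⊛-identityʳ
      ; distrib = ⊛-distribˡ , ⊛-distribʳ }
    ; *-comm = ⊛-comm }

  -- The same ring with the function-valued equality _≈ₚ_: its raw ring is
  -- then definitionally Poly rawRing, as needed to take polynomials over it.
  commutativeRing : CommutativeRing c ℓ
  commutativeRing = record
    { Carrier = Pol ; _≈_ = _≈ₚ_ ; _+_ = _⊕_ ; _*_ = _⊛_ ; -_ = ⊝_ ; 0# = [] ; 1# = 1# ∷ []
    ; isCommutativeRing = record
      { isRing = record
        { +-isAbelianGroup = record
          { isGroup = record
            { isMonoid = record
              { isSemigroup = record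
                { isMagma = record
                  { isEquivalence = record
                    { refl = λ {f} → coef-≈ (≋-refl {f})
                    ; sym = λ {f} {g} p → coef-≈ (≋-sym {f} {g} (mk≋ p))
                    ; trans = λ {f} {g} {h} p q → coef-≈ (≋-trans {f} {g} {h} (mk≋ p) (mk≋ q)) }
                  ; ∙-cong = λ {f} {f′} {g} {g′} p q → coef-≈ (⊕-cong {f} {f′} {g} {g′} (mk≋ p) (mk≋ q)) }
                ; assoc = λ f g h → coef-≈ (⊕-assoc f g h) }
              ; identity = (λ f → coef-≈ (⊕-identityˡ f)) , (λ f → coef-≈ (⊕-identityʳ f)) }
            ; inverse = (λ f → coef-≈ (⊝-inverseˡ f)) , (λ f → coef-≈ (⊝-inverseʳ f))
            ; ⁻¹-cong = λ {f} {f′} p → coef-≈ (⊝-cong {f} {f′} (mk≋ p)) }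
          ; comm = λ f g → coef-≈ (⊕-comm f g) }
        ; *-cong = λ {f} {f′} {g} {g′} p q → coef-≈ (⊛-cong {f} {f′} {g} {g′} (mk≋ p) (mk≋ q))
        ; *-assoc = λ f g h → coef-≈ (⊛-assoc f g h)
        ; *-identity = (λ f → coef-≈ (⊛-identityˡ f)) , (λ f → coef-≈ (⊛-identityʳ f))
        ; distrib = (λ f g h → coef-≈ (⊛-distribˡ f g h)) , (λ h f g → coef-≈ (⊛-distribʳ h f g)) }
      ; *-comm = λ f g → coef-≈ (⊛-comm f g) } }

  X-⊛ : ∀ f → X ⊛ f ≋ 0# ∷ f
  X-⊛ f = ≋-trans (⊕-cong (scale-0# f) (∷-cong refl (⊛-identityˡ f))) (⊕-identityˡ (0# ∷ f))

  horner : ∀ a f → a ∷ f ≋ cst a ⊕ (X ⊛ f)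
  horner a f = ≋-sym (≋-trans (⊕-cong (≋-refl {cst a}) (X-⊛ f)) (∷-cong (+-identityʳ a) ≋-refl))

  coef-cst⊛ : ∀ a f i → coef (cst a ⊛ f) i ≈ a * coef f i
  coef-cst⊛ a f i =
    trans (coef-⊕ (scale a f) (0# ∷ []) i)
          (trans (+-cong (coef-scale a f i) (coef-≈ 0∷[]≋[] i)) (+-identityʳ _))

  coef-∷⊛-zero : ∀ a f g → coef ((a ∷ f) ⊛ g) 0 ≈ a * coef g 0
  coef-∷⊛-zero a f g =
    trans (coef-⊕ (scale a g) (0# ∷ (f ⊛ g)) 0) (trans (+-identityʳ _) (coef-scale a g 0))

  cst-isRingHomomorphism : IsRingHomomorphism rawRing (CommutativeRing.rawRing commutativeRing) cst
  cst-isRingHomomorphism = mkIsRingHomomorphism R commutativeRing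
    (λ {a} {b} a≈b → coef-≈ (∷-cong {a} {b} {[]} {[]} a≈b ≋-refl))
    (λ a b → coef-≈ (≋-refl {cst (a + b)}))
    (λ a b → coef-≈ (∷-cong {a * b} {a * b + 0#} {[]} {[]} (sym (+-identityʳ _)) ≋-refl))
    (coef-≈ 0∷[]≋[])
    (coef-≈ (≋-refl {cst 1#}))
    (λ a → coef-≈ (≋-refl {cst (- a)}))

  X-nonZeroDivisor : NonZeroDivisor commutativeRing X
  X-nonZeroDivisor z X⊛z≈0 j = trans (sym (coef-≈ (X-⊛ z) (suc j))) (X⊛z≈0 (suc j))

  module _ {p : Pol} {d : ℕ} (lead : coef p d ≈ 1#) (above : ∀ i → d < i → coef p i ≈ 0#) where

    coef-⊛-monic : ∀ r n → (∀ j → n < j → coef r j ≈ 0#) → coef (r ⊛ p) (n +ℕ d) ≈ coef r n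
    coef-⊛-monic []      n       r≈0 = refl
    coef-⊛-monic (b ∷ r) zero    r≈0 = begin
      coef (scale b p ⊕ (0# ∷ (r ⊛ p))) d         ≈⟨ coef-⊕ (scale b p) (0# ∷ (r ⊛ p)) d ⟩
      coef (scale b p) d + coef (0# ∷ (r ⊛ p)) d  ≈⟨ +-cong (trans (coef-scale b p d) (trans (*-congˡ lead) (*-identityʳ b)))
                                                            (coef-≈ (≋-trans (∷-cong refl (⊛-zeroˡ {r} p r≋0)) 0∷[]≋[]) d) ⟩
      b + 0#                                       ≈⟨ +-identityʳ b ⟩
      b                                            ∎
      where
        open ≈-Reasoning setoid
        r≋0 : r ≋ []
        r≋0 = mk≋ λ j → r≈0 (suc j) (s≤s z≤n)
    coef-⊛-monic (b ∷ r) (suc n) r≈0 = begin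
      coef (scale b p ⊕ (0# ∷ (r ⊛ p))) (suc (n +ℕ d))      ≈⟨ coef-⊕ (scale b p) (0# ∷ (r ⊛ p)) (suc (n +ℕ d)) ⟩
      coef (scale b p) (suc (n +ℕ d)) + coef (r ⊛ p) (n +ℕ d) ≈⟨ +-cong b·0≈0 (coef-⊛-monic r n (λ j n<j → r≈0 (suc j) (s≤s n<j))) ⟩
      0# + coef r n                                          ≈⟨ +-identityˡ _ ⟩
      coef r n                                               ∎
      where
        open ≈-Reasoning setoid
        b·0≈0 : coef (scale b p) (suc (n +ℕ d)) ≈ 0#
        b·0≈0 = trans (coef-scale b p _) (trans (*-congˡ (above _ (s≤s (ℕ.m≤n+m d n)))) (zeroʳ b))

    -- Descending induction on n: once z vanishes above n, the coefficient of
    -- z ⊛ p at n + d is that of z at n.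
    monic-nonZeroDivisor : NonZeroDivisor commutativeRing p
    monic-nonZeroDivisor z p⊛z≈0 n = vanish (length z) n (ℕ.m≤n+m (length z) n)
      where
        z⊛p≈0 : ∀ i → coef (z ⊛ p) i ≈ 0#
        z⊛p≈0 i = trans (coef-≈ (⊛-comm z p) i) (p⊛z≈0 i)
        vanish : ∀ m n → length z ≤ n +ℕ m → coef z n ≈ 0#
        vanish zero    n le = reflexive (coeff-beyond rawRing z (≡.subst (length z ≤_) (ℕ.+-identityʳ n) le))
        vanish (suc m) n le = trans (sym (coef-⊛-monic z n above-n)) (z⊛p≈0 (n +ℕ d))
          where
            above-n : ∀ j → n < j → coef z j ≈ 0#
            above-n j n<j = vanish m j (ℕ.≤-trans le (≡.subst (_≤ j +ℕ m) (≡.sym (ℕ.+-suc n m)) (ℕ.+-monoˡ-≤ m n<j)))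

  -- Sealed copies of the ring operations: ring reasoning needs Agda to
  -- recover the operands of _+_ and _*_ from a goal, which fails once ⊕
  -- and ⊛ have computed on concrete lists.
  opaque
    infixl 6 _+ˢ_
    infixl 7 _*ˢ_
    _+ˢ_ : Pol → Pol → Pol
    _+ˢ_ = _⊕_

    _*ˢ_ : Pol → Pol → Pol
    _*ˢ_ = _⊛_

    -ˢ_ : Pol → Pol
    -ˢ_ = ⊝_

    +ˢ≡⊕ : ∀ f g → f +ˢ g ≡ f ⊕ g
    +ˢ≡⊕ f g = ≡.refl

    *ˢ≡⊛ : ∀ f g → f *ˢ g ≡ f ⊛ g
    *ˢ≡⊛ f g = ≡.refl

    -ˢ≡⊝ : ∀ f → -ˢ f ≡ ⊝ f
    -ˢ≡⊝ f = ≡.refl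

    sealed-isCommutativeRing : IsCommutativeRing _≋_ _+ˢ_ _*ˢ_ -ˢ_ [] (1# ∷ [])
    sealed-isCommutativeRing = ≋-isCommutativeRing

    hornerˢ : ∀ a f → a ∷ f ≋ cst a +ˢ X *ˢ f
    hornerˢ = horner

    coef-+ˢ : ∀ f g i → coef (f +ˢ g) i ≈ coef f i + coef g i
    coef-+ˢ = coef-⊕

    coef--ˢ : ∀ f i → coef (-ˢ f) i ≈ - coef f i
    coef--ˢ = coef-⊝

    coef-cst*ˢ : ∀ a f i → coef (cst a *ˢ f) i ≈ a * coef f i
    coef-cst*ˢ = coef-cst⊛

    X-*ˢ : ∀ f → X *ˢ f ≋ 0# ∷ f
    X-*ˢ = X-⊛

    coef-∷*ˢ-zero : ∀ a f g → coef ((a ∷ f) *ˢ g) 0 ≈ a * coef g 0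
    coef-∷*ˢ-zero = coef-∷⊛-zero

  sealedRing : CommutativeRing c ℓ
  sealedRing = record { isCommutativeRing = sealed-isCommutativeRing }

  private
    module Pˢ = CommutativeRing sealedRing

  powˢ≡pow : ∀ f n → pow Pˢ.rawRing f n ≡ pow (Poly rawRing) f n
  powˢ≡pow f zero    = ≡.refl
  powˢ≡pow f (suc n) = ≡.trans (*ˢ≡⊛ f _) (≡.cong (f ⊛_) (powˢ≡pow f n))

  module _ {c′ ℓ′ : Level} {T : CommutativeRing c′ ℓ′} where
    private module T = CommutativeRing T

    sealᵀ : ∀ {φ} → IsRingHomomorphism T.rawRing (CommutativeRing.rawRing commutativeRing) φ →
            IsRingHomomorphism T.rawRing Pˢ.rawRing φ
    sealᵀ {φ} φ-hom = mkIsRingHomomorphism T sealedRing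
      (λ a≈b → mk≋ (⟦⟧-cong a≈b))
      (λ a b → ≋-trans (mk≋ (+-homo a b)) (≡⇒≋ (≡.sym (+ˢ≡⊕ (φ a) (φ b)))))
      (λ a b → ≋-trans (mk≋ (*-homo a b)) (≡⇒≋ (≡.sym (*ˢ≡⊛ (φ a) (φ b)))))
      (mk≋ 0#-homo)
      (mk≋ 1#-homo)
      (λ a → ≋-trans (mk≋ (-‿homo a)) (≡⇒≋ (≡.sym (-ˢ≡⊝ (φ a)))))
      where open IsRingHomomorphism φ-hom

    sealˢ : ∀ {φ} → IsRingHomomorphism (CommutativeRing.rawRing commutativeRing) T.rawRing φ →
            IsRingHomomorphism Pˢ.rawRing T.rawRing φ
    sealˢ {φ} φ-hom = mkIsRingHomomorphism sealedRing T
      (λ {f} {g} f≋g → ⟦⟧-cong {f} {g} (coef-≈ f≋g))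
      (λ f g → T.trans (T.reflexive (≡.cong φ (+ˢ≡⊕ f g))) (+-homo f g))
      (λ f g → T.trans (T.reflexive (≡.cong φ (*ˢ≡⊛ f g))) (*-homo f g))
      0#-homo
      1#-homo
      (λ f → T.trans (T.reflexive (≡.cong φ (-ˢ≡⊝ f))) (-‿homo f))
      where open IsRingHomomorphism φ-hom

  cst-isRingHomomorphismˢ : IsRingHomomorphism rawRing Pˢ.rawRing cst
  cst-isRingHomomorphismˢ = sealᵀ {T = R} cst-isRingHomomorphism

  decompˢ : ∀ f → f ≋ cst (coef f 0) +ˢ X *ˢ drop 1 f
  decompˢ []      = Pˢ.sym (Pˢ.trans (Pˢ.+-cong 0∷[]≋[] (Pˢ.zeroʳ X)) (Pˢ.+-identityʳ []))
  decompˢ (a ∷ f) = hornerˢ a f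

  coef-Xpow*ˢ : ∀ k f i → i < k → coef (pow Pˢ.rawRing X k *ˢ f) i ≈ 0#
  coef-Xpow*ˢ (suc k) f zero    _         =
    trans (coef-≈ (Pˢ.*-assoc X _ f) 0) (coef-≈ (X-*ˢ _) 0)
  coef-Xpow*ˢ (suc k) f (suc i) (s≤s i<k) =
    trans (coef-≈ (Pˢ.*-assoc X _ f) (suc i)) (trans (coef-≈ (X-*ˢ _) (suc i)) (coef-Xpow*ˢ k f i i<k))

module Evaluation {c₁ ℓ₁ c₂ ℓ₂ : Level} (S : CommutativeRing c₁ ℓ₁) (T : CommutativeRing c₂ ℓ₂)
  {φ : CommutativeRing.Carrier S → CommutativeRing.Carrier T}
  (φ-hom : IsRingHomomorphism (CommutativeRing.rawRing S) (CommutativeRing.rawRing T) φ)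
  (τ : CommutativeRing.Carrier T) where
  private
    module S = CommutativeRing S
    module P = Polynomials S
    module φ = IsRingHomomorphism φ-hom
  open CommutativeRing T
  open import Algebra.Properties.Ring ring using (-0#≈0#; -‿distribʳ-*; -‿+-comm)
  open import Algebra.Solver.Ring.NaturalCoefficients.Default commutativeSemiring
  open ≈-Reasoning setoid

  ev : P.Pol → Carrier
  ev []      = 0#
  ev (a ∷ f) = φ a + τ * ev f

  ev-zero : ∀ {f} → f P.≋ [] → ev f ≈ 0#
  ev-zero {[]}    f≋0 = refl
  ev-zero {a ∷ f} f≋0 = begin
    φ a + τ * ev f ≈⟨ +-cong (trans (φ.⟦⟧-cong {a} {S.0#} (P.coef-≈ f≋0 0)) φ.0#-homo)
                             (*-congˡ (ev-zero {f} (P.mk≋ (P.coef-≈ f≋0 ∘ suc)))) ⟩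
    0# + τ * 0#    ≈⟨ trans (+-identityˡ _) (zeroʳ τ) ⟩
    0#             ∎

  ev-cong : ∀ {f g} → f P.≋ g → ev f ≈ ev g
  ev-cong {[]}    {g}     f≋g = sym (ev-zero (P.≋-sym f≋g))
  ev-cong {a ∷ f} {[]}    f≋g = ev-zero f≋g
  ev-cong {a ∷ f} {b ∷ g} f≋g =
    +-cong (φ.⟦⟧-cong {a} {b} (P.coef-≈ f≋g 0)) (*-congˡ (ev-cong (P.∷-injectiveʳ f≋g)))

  ev-⊕ : ∀ f g → ev (f P.⊕ g) ≈ ev f + ev g
  ev-⊕ []      g       = sym (+-identityˡ _)
  ev-⊕ (a ∷ f) []      = sym (+-identityʳ _)
  ev-⊕ (a ∷ f) (b ∷ g) = begin
    φ (a S.+ b) + τ * ev (f P.⊕ g)  ≈⟨ +-cong (φ.+-homo a b) (*-congˡ (ev-⊕ f g)) ⟩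
    (φ a + φ b) + τ * (ev f + ev g) ≈⟨ solve 5 (λ A B t F G → (A :+ B) :+ t :* (F :+ G) := (A :+ t :* F) :+ (B :+ t :* G))
                                              refl (φ a) (φ b) τ (ev f) (ev g) ⟩
    (φ a + τ * ev f) + (φ b + τ * ev g) ∎

  ev-scale : ∀ a g → ev (P.scale a g) ≈ φ a * ev g
  ev-scale a []      = sym (zeroʳ _)
  ev-scale a (b ∷ g) = begin
    φ (a S.* b) + τ * ev (P.scale a g) ≈⟨ +-cong (φ.*-homo a b) (*-congˡ (ev-scale a g)) ⟩
    φ a * φ b + τ * (φ a * ev g)       ≈⟨ solve 4 (λ A B t G → A :* B :+ t :* (A :* G) := A :* (B :+ t :* G))
                                                 refl (φ a) (φ b) τ (ev g) ⟩
    φ a * (φ b + τ * ev g)             ∎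

  ev-⊛ : ∀ f g → ev (f P.⊛ g) ≈ ev f * ev g
  ev-⊛ []      g = sym (zeroˡ _)
  ev-⊛ (a ∷ f) g = begin
    ev (P.scale a g P.⊕ (S.0# ∷ (f P.⊛ g)))       ≈⟨ ev-⊕ (P.scale a g) (S.0# ∷ (f P.⊛ g)) ⟩
    ev (P.scale a g) + (φ S.0# + τ * ev (f P.⊛ g)) ≈⟨ +-cong (ev-scale a g) (+-cong φ.0#-homo (*-congˡ (ev-⊛ f g))) ⟩
    φ a * ev g + (0# + τ * (ev f * ev g))          ≈⟨ solve 4 (λ A G t F → A :* G :+ (con 0 :+ t :* (F :* G)) := (A :+ t :* F) :* G)
                                                             refl (φ a) (ev g) τ (ev f) ⟩
    (φ a + τ * ev f) * ev g                         ∎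

  ev-⊝ : ∀ f → ev (P.⊝ f) ≈ - ev f
  ev-⊝ []      = sym -0#≈0#
  ev-⊝ (a ∷ f) = begin
    φ (S.- a) + τ * ev (P.⊝ f) ≈⟨ +-cong (φ.-‿homo a) (*-congˡ (ev-⊝ f)) ⟩
    - φ a + τ * - ev f         ≈⟨ +-congˡ (sym (-‿distribʳ-* τ (ev f))) ⟩
    - φ a + - (τ * ev f)       ≈⟨ -‿+-comm _ _ ⟩
    - (φ a + τ * ev f)         ∎

  ev-cst : ∀ a → ev (P.cst a) ≈ φ a
  ev-cst a = trans (+-congˡ (zeroʳ τ)) (+-identityʳ _)

  ev-X : ev P.X ≈ τ
  ev-X = begin
    φ S.0# + τ * ev (P.cst S.1#) ≈⟨ +-cong φ.0#-homo (*-congˡ (trans (ev-cst S.1#) φ.1#-homo)) ⟩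
    0# + τ * 1#                  ≈⟨ trans (+-identityˡ _) (*-identityʳ τ) ⟩
    τ                            ∎

  ev-isRingHomomorphism : IsRingHomomorphism (CommutativeRing.rawRing P.commutativeRing) rawRing ev
  ev-isRingHomomorphism = mkIsRingHomomorphism P.commutativeRing T
    (λ {f} {g} f≈g → ev-cong {f} {g} (P.mk≋ f≈g)) ev-⊕ ev-⊛ refl (trans (ev-cst S.1#) φ.1#-homo) ev-⊝

  ev-isRingHomomorphismˢ : IsRingHomomorphism (CommutativeRing.rawRing P.sealedRing) rawRing ev
  ev-isRingHomomorphismˢ = P.sealˢ {T = T} ev-isRingHomomorphism

module LinearFactor {c ℓ : Level} (S : CommutativeRing c ℓ) (x : CommutativeRing.Carrier S) where
  private
    module S = CommutativeRing S
    module P = Polynomials S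
  open P using (Pol; X; cst; coef; mk≋; coef-≈)
  open CommutativeRing P.sealedRing hiding (zero)
  open Congruence P.sealedRing
  open import Algebra.Properties.Ring ring using (-‿distribˡ-*; x[y-z]≈xy-xz)
  open import Algebra.Properties.Group +-group using (x∙y⁻¹≈ε⇒x≈y)
  open import Algebra.Solver.Ring.NaturalCoefficients.Default commutativeSemiring

  u : Pol
  u = cst x - X

  u+X≈x : u + X ≈ cst x
  u+X≈x = trans (+-assoc (cst x) (- X) X) (trans (+-congˡ (-‿inverseˡ X)) (+-identityʳ (cst x)))

  open Evaluation S S (Identity.isRingHomomorphism S.rawRing S.refl) x public
    using () renaming (ev to evₓ; ev-cst to evₓ-cst; ev-X to evₓ-X; ev-isRingHomomorphismˢ to evₓ-isRingHomomorphism)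

  private
    module evₓ = IsRingHomomorphism evₓ-isRingHomomorphism
    module cst = IsRingHomomorphism P.cst-isRingHomomorphismˢ

  evₓ-u* : ∀ z → evₓ (u * z) S.≈ S.0#
  evₓ-u* z = S.trans (evₓ.*-homo u z) (S.trans (S.*-congʳ evₓ-u) (S.zeroˡ _))
    where
      evₓ-u : evₓ u S.≈ S.0#
      evₓ-u = S.trans (evₓ.+-homo (cst x) (- X))
                (S.trans (S.+-cong (evₓ-cst x) (S.trans (evₓ.-‿homo X) (S.-‿cong evₓ-X))) (S.-‿inverseʳ x))

  coef-u* : ∀ z i → coef (u * z) i S.≈ x S.* coef z i S.- coef (S.0# ∷ z) i
  coef-u* z i = begin
    coef (u * z) i                             ≈⟨ coef-≈ (distribʳ z (cst x) (- X)) i ⟩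
    coef (cst x * z + - X * z) i               ≈⟨ P.coef-+ˢ (cst x * z) (- X * z) i ⟩
    coef (cst x * z) i S.+ coef (- X * z) i     ≈⟨ S.+-cong (P.coef-cst*ˢ x z i) coef-−X* ⟩
    x S.* coef z i S.- coef (S.0# ∷ z) i       ∎
    where
      open ≈-Reasoning S.setoid
      coef-−X* : coef (- X * z) i S.≈ S.- coef (S.0# ∷ z) i
      coef-−X* = S.trans (coef-≈ (sym (-‿distribˡ-* X z)) i)
                   (S.trans (P.coef--ˢ (X * z) i) (S.-‿cong (coef-≈ (P.X-*ˢ z) i)))

  -- Comparing coefficients in (x − t) z = 0 gives x zᵢ = zᵢ₋₁.
  u-nonZeroDivisor : NonZeroDivisor S x → NonZeroDivisor P.sealedRing u
  u-nonZeroDivisor x-nzd z u*z≈0 = mk≋ vanish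
    where
      x*zᵢ≈0 : ∀ i → coef (S.0# ∷ z) i S.≈ S.0# → x S.* coef z i S.≈ S.0#
      x*zᵢ≈0 i zᵢ₋₁≈0 = begin
        x S.* coef z i                        ≈⟨ S.+-identityʳ _ ⟨
        x S.* coef z i S.+ S.0#               ≈⟨ S.+-congˡ (S.trans (S.-‿cong zᵢ₋₁≈0) -0#≈0#) ⟨
        x S.* coef z i S.- coef (S.0# ∷ z) i  ≈⟨ coef-u* z i ⟨
        coef (u * z) i                        ≈⟨ coef-≈ u*z≈0 i ⟩
        S.0#                                  ∎
        where
          open ≈-Reasoning S.setoid
          open import Algebra.Properties.Ring S.ring using (-0#≈0#)
      vanish : ∀ i → coef z i S.≈ S.0#
      vanish zero    = x-nzd _ (x*zᵢ≈0 zero S.refl)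
      vanish (suc i) = x-nzd _ (x*zᵢ≈0 (suc i) (vanish i))

  u-divMod : ∀ h → Σ Pol λ q → Σ S.Carrier λ r → h ≈ u * q + cst r
  u-divMod []       = [] , S.0# , sym (trans (+-cong (zeroʳ u) cst.0#-homo) (+-identityʳ 0#))
  u-divMod (h₀ ∷ h) with u-divMod h
  ... | q , r , h≈uq+r = S.- r ∷ q , h₀ S.+ x S.* r , (begin
    h₀ ∷ h                                    ≈⟨ P.hornerˢ h₀ h ⟩
    cst h₀ + X * h                            ≈⟨ +-congˡ (*-congˡ h≈uq+r) ⟩
    cst h₀ + X * (u * q + cst r)              ≈⟨ +-identityʳ _ ⟨
    (cst h₀ + X * (u * q + cst r)) + 0#       ≈⟨ +-congˡ (trans (*-congˡ (-‿inverseˡ (cst r))) (zeroʳ u)) ⟨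
    (cst h₀ + X * (u * q + cst r)) + u * (- cst r + cst r)
      ≈⟨ solve 6 (λ h t U q C N → (h :+ t :* (U :* q :+ C)) :+ U :* (N :+ C) := U :* (N :+ t :* q) :+ (h :+ (U :+ t) :* C))
                 refl (cst h₀) X u q (cst r) (- cst r) ⟩
    u * (- cst r + X * q) + (cst h₀ + (u + X) * cst r)
      ≈⟨ +-cong (*-congˡ (sym (trans (P.hornerˢ (S.- r) q) (+-congʳ (cst.-‿homo r)))))
                (+-congˡ (*-congʳ u+X≈x)) ⟩
    u * (S.- r ∷ q) + (cst h₀ + cst x * cst r)
      ≈⟨ +-congˡ (sym (trans (cst.+-homo h₀ (x S.* r)) (+-congˡ (cst.*-homo x r)))) ⟩
    u * (S.- r ∷ q) + cst (h₀ S.+ x S.* r)   ∎)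
    where open ≈-Reasoning setoid

  -- Write h = (x − t) q + r with r constant in t; substituting t := x
  -- gives p r = 0, so r = 0 and x − t can be cancelled.
  u-cancel-mod : NonZeroDivisor S x → ∀ {π p} → NonZeroDivisor S p → evₓ π S.≈ p →
                 ∀ {y y′} → u * y ≈ u * y′ mod π → y ≈ y′ mod π
  u-cancel-mod x-nzd {π} {p} p-nzd evₓπ≈p {y} {y′} (h , u*y≈) with u-divMod h
  ... | q , r , h≈uq+r = q , x∙y⁻¹≈ε⇒x≈y y w (u-nonZeroDivisor x-nzd _ u*[y-w]≈0)
    where
      w = y′ + π * q

      u*y≈u*w+π*r : u * y ≈ u * w + π * cst r
      u*y≈u*w+π*r = begin
        u * y                          ≈⟨ u*y≈ ⟩
        u * y′ + π * h                 ≈⟨ +-congˡ (*-congˡ h≈uq+r) ⟩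
        u * y′ + π * (u * q + cst r)   ≈⟨ solve 5 (λ U y′ π q C → U :* y′ :+ π :* (U :* q :+ C) := U :* (y′ :+ π :* q) :+ π :* C)
                                                  refl u y′ π q (cst r) ⟩
        u * w + π * cst r              ∎
        where open ≈-Reasoning setoid

      p*r≈0 : p S.* r S.≈ S.0#
      p*r≈0 = begin
        p S.* r                               ≈⟨ S.*-cong evₓπ≈p (evₓ-cst r) ⟨
        evₓ π S.* evₓ (cst r)                 ≈⟨ evₓ.*-homo π (cst r) ⟨
        evₓ (π * cst r)                       ≈⟨ S.+-identityˡ _ ⟨
        S.0# S.+ evₓ (π * cst r)              ≈⟨ S.+-congʳ (evₓ-u* w) ⟨
        evₓ (u * w) S.+ evₓ (π * cst r)       ≈⟨ evₓ.+-homo (u * w) (π * cst r) ⟨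
        evₓ (u * w + π * cst r)               ≈⟨ evₓ.⟦⟧-cong (sym u*y≈u*w+π*r) ⟩
        evₓ (u * y)                           ≈⟨ evₓ-u* y ⟩
        S.0#                                  ∎
        where open ≈-Reasoning S.setoid

      u*[y-w]≈0 : u * (y - w) ≈ 0#
      u*[y-w]≈0 = trans (x[y-z]≈xy-xz u y w) (trans (+-congʳ u*y≈u*w) (-‿inverseʳ (u * w)))
        where
          u*y≈u*w : u * y ≈ u * w
          u*y≈u*w = trans u*y≈u*w+π*r (trans (+-congˡ (trans (*-congˡ cst-r≈0) (zeroʳ π))) (+-identityʳ _))
            where cst-r≈0 = trans (cst.⟦⟧-cong (p-nzd r p*r≈0)) cst.0#-homo

module Chain {c ℓ : Level} (A : CommutativeRing c ℓ) where
  open CommutativeRing A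
  open Congruence A
  open import Algebra.Solver.Ring.NaturalCoefficients.Default commutativeSemiring

  module _ {u π p Q : Carrier}
    (u-cancel : ∀ {y y′} → u * y ≈ u * y′ mod π → y ≈ y′ mod π)
    (uQ+π≈p : u * Q + π ≈ p) where

    u-divide : ∀ {y z} → u * y ≈ p * z mod π → y ≈ z * Q mod π
    u-divide {y} {z} u*y≈p*z = u-cancel (≈mod-trans u*y≈p*z (z , (begin
      p * z           ≈⟨ *-congʳ (sym uQ+π≈p) ⟩
      (u * Q + π) * z ≈⟨ solve 4 (λ u Q π z → (u :* Q :+ π) :* z := u :* (z :* Q) :+ π :* z) refl u Q π z ⟩
      u * (z * Q) + π * z ∎)))
      where open ≈-Reasoning setoid

    chain : ∀ k (s : ℕ → Carrier) →
            u * s 0 ≈ p * pow rawRing p (k ∸ 1) mod π →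
            (∀ l → suc l < k → u * s (suc l) ≈ s l mod π) →
            ∀ l → l < k → s l ≈ pow rawRing p (k ∸ l ∸ 1) * pow rawRing Q (l +ℕ 1) mod π
    chain k s s₀ sₗ₊₁ zero    _     =
      ≈mod-trans (u-divide s₀) (≈⇒≈mod (*-congˡ (sym (*-identityʳ Q))))
    chain k s s₀ sₗ₊₁ (suc l) l+1<k =
      ≈mod-trans (u-divide (≈mod-trans (sₗ₊₁ l l+1<k) (≈mod-trans ih (≈⇒≈mod regroup))))
                 (≈⇒≈mod (trans (*-assoc _ _ _) (*-congˡ (*-comm _ Q))))
      where
        ih = chain k s s₀ sₗ₊₁ l (ℕ.<-trans (ℕ.n<1+n l) l+1<k)
        m = k ∸ suc l ∸ 1
        k∸l∸1≡1+m : ∀ k l → suc l < k → k ∸ l ∸ 1 ≡ suc (k ∸ suc l ∸ 1)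
        k∸l∸1≡1+m (suc (suc k)) zero    _         = ≡.refl
        k∸l∸1≡1+m (suc k)       (suc l) (s≤s l<k) = k∸l∸1≡1+m k l l<k
        regroup : pow rawRing p (k ∸ l ∸ 1) * pow rawRing Q (l +ℕ 1)
                  ≈ p * (pow rawRing p m * pow rawRing Q (l +ℕ 1))
        regroup = trans (*-congʳ (reflexive (≡.cong (pow rawRing p) (k∸l∸1≡1+m k l l+1<k)))) (*-assoc _ _ _)

module Shift {c ℓ : Level} (S : CommutativeRing c ℓ) (x : CommutativeRing.Carrier S) where
  private module S = CommutativeRing S
  module Pt  = Polynomials S
  module PtX = Polynomials Pt.commutativeRing
  open LinearFactor S x public
  private
    module A = CommutativeRing Pt.sealedRing
    module B = CommutativeRing PtX.sealedRing
  open Congruence Pt.sealedRing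

  t : Pt.Pol
  t = Pt.X

  t+X : PtX.Pol
  t+X = t ∷ Pt.cst S.1# ∷ []

  private
    cstₓ-hom : IsRingHomomorphism A.rawRing B.rawRing PtX.cst
    cstₓ-hom = Pt.sealˢ {T = PtX.sealedRing} PtX.cst-isRingHomomorphismˢ
    module cstₓ = IsRingHomomorphism cstₓ-hom

  open Evaluation S PtX.sealedRing (Composition.isRingHomomorphism B.trans Pt.cst-isRingHomomorphismˢ cstₓ-hom) t+X
    public using () renaming (ev to σ; ev-cst to σ-cst; ev-X to σ-t; ev-isRingHomomorphismˢ to σ-isRingHomomorphism)

  private module σ = IsRingHomomorphism σ-isRingHomomorphism

  coefₓ : PtX.Pol → ℕ → Pt.Pol
  coefₓ = PtX.coef

  coefₓ-cong : ∀ {F G} → F B.≈ G → ∀ i → coefₓ F i A.≈ coefₓ G i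
  coefₓ-cong F≈G i = Pt.mk≋ (PtX.coef-≈ F≈G i)

  coefₓ-+ : ∀ F G i → coefₓ (F B.+ G) i A.≈ coefₓ F i A.+ coefₓ G i
  coefₓ-+ F G i = A.trans (Pt.mk≋ (PtX.coef-+ˢ F G i)) (Pt.≡⇒≋ (≡.sym (Pt.+ˢ≡⊕ _ _)))

  coefₓ-cst* : ∀ a F i → coefₓ (PtX.cst a B.* F) i A.≈ a A.* coefₓ F i
  coefₓ-cst* a F i = A.trans (Pt.mk≋ (PtX.coef-cst*ˢ a F i)) (Pt.≡⇒≋ (≡.sym (Pt.*ˢ≡⊛ _ _)))

  coefₓ-∷*-zero : ∀ a G F → coefₓ ((a ∷ G) B.* F) 0 A.≈ a A.* coefₓ F 0
  coefₓ-∷*-zero a G F = A.trans (Pt.mk≋ (PtX.coef-∷*ˢ-zero a G F)) (Pt.≡⇒≋ (≡.sym (Pt.*ˢ≡⊛ _ _)))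

  coefₓ-X* : ∀ F i → coefₓ (PtX.X B.* F) (suc i) A.≈ coefₓ F i
  coefₓ-X* F i = coefₓ-cong (PtX.X-*ˢ F) (suc i)

  coefₓ-Xpow* : ∀ k F i → i < k → coefₓ (pow B.rawRing PtX.X k B.* F) i A.≈ A.0#
  coefₓ-Xpow* k F i i<k = Pt.mk≋ (PtX.coef-Xpow*ˢ k F i i<k)

  coefₓ₀-σ : ∀ F → coefₓ (σ F) 0 A.≈ F
  coefₓ₀-σ []      = A.refl
  coefₓ₀-σ (a ∷ F) = begin
    coefₓ (PtX.cst (Pt.cst a) B.+ t+X B.* σ F) 0 ≈⟨ coefₓ-+ (PtX.cst (Pt.cst a)) (t+X B.* σ F) 0 ⟩
    Pt.cst a A.+ coefₓ (t+X B.* σ F) 0           ≈⟨ A.+-congˡ (coefₓ-∷*-zero t _ (σ F)) ⟩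
    Pt.cst a A.+ t A.* coefₓ (σ F) 0             ≈⟨ A.+-congˡ (A.*-congˡ (coefₓ₀-σ F)) ⟩
    Pt.cst a A.+ t A.* F                         ≈⟨ Pt.hornerˢ a F ⟨
    a ∷ F                                        ∎
    where open ≈-Reasoning A.setoid

  σ-u : σ u B.≈ PtX.cst u B.- PtX.X
  σ-u = begin
    σ (Pt.cst x A.- t)                       ≈⟨ σ.+-homo (Pt.cst x) (A.- t) ⟩
    σ (Pt.cst x) B.+ σ (A.- t)                ≈⟨ B.+-cong (σ-cst x) (B.trans (σ.-‿homo t) (B.-‿cong σ-t)) ⟩
    PtX.cst (Pt.cst x) B.- t+X               ≈⟨ B.+-congˡ (B.-‿cong t+X≈t+X) ⟩
    PtX.cst (Pt.cst x) B.- (PtX.cst t B.+ PtX.X) ≈⟨ B.+-congˡ (-‿+-comm _ _) ⟨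
    PtX.cst (Pt.cst x) B.+ (B.- PtX.cst t B.- PtX.X) ≈⟨ B.+-assoc _ _ _ ⟨
    (PtX.cst (Pt.cst x) B.- PtX.cst t) B.- PtX.X   ≈⟨ B.+-congʳ (B.trans (cstₓ.+-homo (Pt.cst x) (A.- t)) (B.+-congˡ (cstₓ.-‿homo t))) ⟨
    PtX.cst u B.- PtX.X                      ∎
    where
      open ≈-Reasoning B.setoid
      open import Algebra.Properties.Ring B.ring using (-‿+-comm)
      t+X≈t+X : t+X B.≈ PtX.cst t B.+ PtX.X
      t+X≈t+X = B.trans (PtX.hornerˢ t (Pt.cst S.1# ∷ [])) (B.+-congˡ (B.*-identityʳ PtX.X))

  -- Apply σ to  u G + πᵏ = P  and expand  σ π = π + X V.
  σ-identity : ∀ {G π : Pt.Pol} {P : S.Carrier} k → u A.* G A.+ pow A.rawRing π k A.≈ Pt.cst P →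
    Σ PtX.Pol λ W → PtX.cst u B.* σ G B.+ (PtX.cst π B.* W B.+ pow B.rawRing PtX.X k B.* pow B.rawRing (drop 1 (σ π)) k)
                      B.≈ PtX.X B.* σ G B.+ PtX.cst (Pt.cst P)
  σ-identity {G} {π} {P} k uG+πᵏ≈P = W , (begin
    cu B.* σ G B.+ (c′ B.* W B.+ Xᵏ B.* Vᵏ)                    ≈⟨ B.+-congʳ (B.*-congʳ cu≈[cu-X]+X) ⟩
    ((cu B.- PtX.X) B.+ PtX.X) B.* σ G B.+ (c′ B.* W B.+ Xᵏ B.* Vᵏ)
      ≈⟨ solve 5 (λ D X s C K → (D :+ X) :* s :+ (C :+ K) := (D :* s :+ (K :+ C)) :+ X :* s)
                 B.refl (cu B.- PtX.X) PtX.X (σ G) (c′ B.* W) (Xᵏ B.* Vᵏ) ⟩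
    ((cu B.- PtX.X) B.* σ G B.+ (Xᵏ B.* Vᵏ B.+ c′ B.* W)) B.+ PtX.X B.* σ G ≈⟨ B.+-congʳ σ[uG+πᵏ] ⟩
    PtX.cst (Pt.cst P) B.+ PtX.X B.* σ G                       ≈⟨ B.+-comm _ _ ⟩
    PtX.X B.* σ G B.+ PtX.cst (Pt.cst P)                       ∎)
    where
      open ≈-Reasoning B.setoid
      open import Algebra.Solver.Ring.NaturalCoefficients.Default B.commutativeSemiring
      module CB = Congruence PtX.sealedRing
      cu c′ V Xᵏ Vᵏ W : PtX.Pol
      cu = PtX.cst u
      c′ = PtX.cst π
      V = drop 1 (σ π)
      Xᵏ = pow B.rawRing PtX.X k
      Vᵏ = pow B.rawRing V k
      W = proj₁ (CB.pow-+*-≈mod c′ PtX.X V k)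

      σπᵏ : σ (pow A.rawRing π k) B.≈ Xᵏ B.* Vᵏ B.+ c′ B.* W
      σπᵏ = B.trans (pow-homo Pt.sealedRing PtX.sealedRing σ-isRingHomomorphism π k)
              (B.trans (pow-cong PtX.sealedRing σπ≈c′+XV k) (proj₂ (CB.pow-+*-≈mod c′ PtX.X V k)))
        where
          σπ≈c′+XV : σ π B.≈ c′ B.+ PtX.X B.* V
          σπ≈c′+XV = B.trans (PtX.decompˢ (σ π)) (B.+-congʳ (cstₓ.⟦⟧-cong (coefₓ₀-σ π)))

      σ[uG+πᵏ] : (cu B.- PtX.X) B.* σ G B.+ (Xᵏ B.* Vᵏ B.+ c′ B.* W) B.≈ PtX.cst (Pt.cst P)
      σ[uG+πᵏ] = begin
        (cu B.- PtX.X) B.* σ G B.+ (Xᵏ B.* Vᵏ B.+ c′ B.* W) ≈⟨ B.+-cong (B.*-congʳ σ-u) σπᵏ ⟨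
        σ u B.* σ G B.+ σ (pow A.rawRing π k)               ≈⟨ B.+-congʳ (σ.*-homo u G) ⟨
        σ (u A.* G) B.+ σ (pow A.rawRing π k)               ≈⟨ σ.+-homo _ _ ⟨
        σ (u A.* G A.+ pow A.rawRing π k)                   ≈⟨ σ.⟦⟧-cong uG+πᵏ≈P ⟩
        σ (Pt.cst P)                                        ≈⟨ σ-cst P ⟩
        PtX.cst (Pt.cst P)                                  ∎

      cu≈[cu-X]+X : cu B.≈ (cu B.- PtX.X) B.+ PtX.X
      cu≈[cu-X]+X = B.sym (B.trans (B.+-assoc _ _ _) (B.trans (B.+-congˡ (B.-‿inverseˡ PtX.X)) (B.+-identityʳ _)))

  -- Coefficient of X^(l+1) in σ-identity: XᵏVᵏ has none as l + 1 < k,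
  -- and πW only contributes a multiple of π.
  shift-step : ∀ {G π : Pt.Pol} {P : S.Carrier} k → u A.* G A.+ pow A.rawRing π k A.≈ Pt.cst P →
               ∀ l → suc l < k → u A.* coefₓ (σ G) (suc l) ≈ coefₓ (σ G) l mod π
  shift-step {G} {π} {P} k uG+πᵏ≈P l l+1<k = +*≈⇒≈mod (begin
    u A.* s (suc l) A.+ π A.* w                     ≈⟨ A.+-congˡ (A.+-identityʳ _) ⟨
    u A.* s (suc l) A.+ (π A.* w A.+ A.0#)          ≈⟨ coef-lhs ⟨
    coefₓ lhs (suc l)                               ≈⟨ coefₓ-cong identity (suc l) ⟩
    coefₓ (PtX.X B.* σ G B.+ φP) (suc l)            ≈⟨ coefₓ-+ (PtX.X B.* σ G) φP (suc l) ⟩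
    coefₓ (PtX.X B.* σ G) (suc l) A.+ A.0#          ≈⟨ A.+-identityʳ _ ⟩
    coefₓ (PtX.X B.* σ G) (suc l)                   ≈⟨ coefₓ-X* (σ G) l ⟩
    s l                                             ∎)
    where
      open ≈-Reasoning A.setoid
      W : PtX.Pol
      W = proj₁ (σ-identity k uG+πᵏ≈P)
      identity = proj₂ (σ-identity k uG+πᵏ≈P)
      s : ℕ → Pt.Pol
      s = coefₓ (σ G)
      w : Pt.Pol
      w = coefₓ W (suc l)
      φP XᵏVᵏ lhs : PtX.Pol
      φP = PtX.cst (Pt.cst P)
      XᵏVᵏ = pow B.rawRing PtX.X k B.* pow B.rawRing (drop 1 (σ π)) k
      lhs = PtX.cst u B.* σ G B.+ (PtX.cst π B.* W B.+ XᵏVᵏ)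
      coef-lhs : coefₓ lhs (suc l) A.≈ u A.* s (suc l) A.+ (π A.* w A.+ A.0#)
      coef-lhs = A.trans (coefₓ-+ (PtX.cst u B.* σ G) (PtX.cst π B.* W B.+ XᵏVᵏ) (suc l))
                   (A.+-cong (coefₓ-cst* u (σ G) (suc l))
                     (A.trans (coefₓ-+ (PtX.cst π B.* W) XᵏVᵏ (suc l))
                       (A.+-cong (coefₓ-cst* π W (suc l))
                                 (coefₓ-Xpow* k (pow B.rawRing (drop 1 (σ π)) k) (suc l) l+1<k))))

module Bivariate {c ℓ : Level} (R : CommutativeRing c ℓ) where
  private module R = CommutativeRing R
  open Constructions R.rawRing
  module Px = Polynomials R
  open Shift Px.commutativeRing Px.X
  open CommutativeRing Pt.sealedRing hiding (zero)
  open Congruence Pt.sealedRing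
  open import Algebra.Solver.Ring.NaturalCoefficients.Default commutativeSemiring

  private module cstₜ = IsRingHomomorphism Pt.cst-isRingHomomorphismˢ

  -- The divided difference (g(x) − g(t)) / (x − t).
  Δ : Px.Pol → Pt.Pol
  Δ []      = []
  Δ (a ∷ g) = g ∷ Δ g

  coeff-Δ : ∀ g i j → coeff R.rawRing (coeff Rx (Δ g) i) j ≡ coeff R.rawRing g (i +ℕ j +ℕ 1)
  coeff-Δ []      i       j = ≡.refl
  coeff-Δ (a ∷ g) zero    j = ≡.cong (coeff R.rawRing (a ∷ g)) (ℕ.+-comm 1 j)
  coeff-Δ (a ∷ g) (suc i) j = coeff-Δ g i j

  coeff-D : ∀ g i j → coeff R.rawRing (D g i) j ≡ coeff R.rawRing g (i +ℕ j +ℕ 1)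
  coeff-D g i j = ≡.trans (≡.cong (λ f → coeff R.rawRing f j) (map-upTo _ (fdeg g ∸ i)))
                          (coeff-applyUpTo R.rawRing _ (fdeg g ∸ i) beyond j)
    where
      beyond : ∀ j → fdeg g ∸ i ≤ j → coeff R.rawRing g (i +ℕ j +ℕ 1) ≡ R.0#
      beyond j le = coeff-beyond R.rawRing g (begin
        length g        ≤⟨ ℕ.m≤n+m∸n (length g) 1 ⟩
        1 +ℕ fdeg g     ≤⟨ ℕ.+-monoʳ-≤ 1 (ℕ.≤-trans (ℕ.m≤n+m∸n (fdeg g) i) (ℕ.+-monoʳ-≤ i le)) ⟩
        1 +ℕ (i +ℕ j)   ≡⟨ ℕ.+-comm 1 (i +ℕ j) ⟩
        i +ℕ j +ℕ 1     ∎)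
        where open ℕ.≤-Reasoning

  coeff-O2 : ∀ g i j → coeff R.rawRing (coeff Rx (O2 g) i) j ≡ coeff R.rawRing g (i +ℕ j +ℕ 1)
  coeff-O2 g i j = ≡.trans (≡.cong (λ f → coeff R.rawRing f j) O2ᵢ≡Dᵢ) (coeff-D g i j)
    where
      D-beyond : ∀ j → fdeg g ≤ j → D g j ≡ []
      D-beyond j le =
        ≡.cong (λ n → map (λ j′ → coeff R.rawRing g (j +ℕ j′ +ℕ 1)) (upTo n)) (ℕ.m≤n⇒m∸n≡0 le)
      O2ᵢ≡Dᵢ : coeff Rx (O2 g) i ≡ D g i
      O2ᵢ≡Dᵢ = ≡.trans (≡.cong (λ f → coeff Rx f i) (map-upTo (D g) (fdeg g)))
                       (coeff-applyUpTo Rx (D g) (fdeg g) D-beyond i)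

  O2≈Δ : ∀ g → O2 g ≈ Δ g
  O2≈Δ g = Pt.mk≋ λ i j → R.reflexive (≡.trans (coeff-O2 g i j) (≡.sym (coeff-Δ g i j)))

  Δ-spec : ∀ g → u * Δ g + inT g ≈ inX g
  Δ-spec []      = trans (+-identityʳ _) (trans (zeroʳ u) (sym Pt.0∷[]≋[]))
  Δ-spec (a ∷ g) = begin
    u * (g ∷ Δ g) + (Px.cst a ∷ inT g)
      ≈⟨ +-cong (*-congˡ (Pt.hornerˢ g (Δ g))) (Pt.hornerˢ (Px.cst a) (inT g)) ⟩
    u * (inX g + t * Δ g) + (inX (Px.cst a) + t * inT g)
      ≈⟨ solve 6 (λ U t Q I g a → U :* (g :+ t :* Q) :+ (a :+ t :* I) := a :+ (U :* g :+ t :* (U :* Q :+ I)))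
                 refl u t (Δ g) (inT g) (inX g) (inX (Px.cst a)) ⟩
    inX (Px.cst a) + (u * inX g + t * (u * Δ g + inT g))
      ≈⟨ +-congˡ (+-congˡ (*-congˡ (Δ-spec g))) ⟩
    inX (Px.cst a) + (u * inX g + t * inX g)
      ≈⟨ +-congˡ (trans (sym (distribʳ (inX g) u t)) (*-congʳ u+X≈x)) ⟩
    inX (Px.cst a) + inX Px.X * inX g
      ≈⟨ trans (cstₜ.+-homo _ _) (+-congˡ (cstₜ.*-homo Px.X g)) ⟨
    inX (Px.cst a Px.⊕ Px.X Px.⊛ g)
      ≈⟨ cstₜ.⟦⟧-cong {Px.cst a Px.⊕ Px.X Px.⊛ g} {a ∷ g} (Px.coef-≈ (Px.≋-sym (Px.horner a g))) ⟩
    inX (a ∷ g) ∎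
    where open ≈-Reasoning setoid

  open Evaluation R Pt.sealedRing (Composition.isRingHomomorphism trans Px.cst-isRingHomomorphism Pt.cst-isRingHomomorphismˢ) t
    using () renaming (ev to evₜ; ev-isRingHomomorphism to evₜ-isRingHomomorphism)

  inT≈evₜ : ∀ g → inT g ≈ evₜ g
  inT≈evₜ []      = refl
  inT≈evₜ (a ∷ g) = trans (Pt.hornerˢ (Px.cst a) (inT g)) (+-congˡ (*-congˡ (inT≈evₜ g)))

  inT-pow : ∀ g n → inT (pow Rx g n) ≈ pow rawRing (inT g) n
  inT-pow g n = trans (inT≈evₜ _) (trans (pow-homo Px.commutativeRing Pt.sealedRing evₜ-isRingHomomorphism g n)
                                         (pow-cong Pt.sealedRing (sym (inT≈evₜ g)) n))

  evₓ-inT : ∀ g → evₓ (inT g) Px.≋ g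
  evₓ-inT []      = Px.≋-refl
  evₓ-inT (a ∷ g) = Px.≋-trans (Px.⊕-cong (Px.≋-refl {Px.cst a}) (Px.⊛-congʳ Px.X (evₓ-inT g))) (Px.≋-sym (Px.horner a g))

  shift≡σ : ∀ F → shift F ≡ σ F
  shift≡σ []      = ≡.refl
  shift≡σ (a ∷ F) =
    ≡.trans (≡.cong (λ G → PtX.cst (Pt.cst a) PtX.⊕ (t+X PtX.⊛ G)) (shift≡σ F))
            (≡.sym (≡.trans (PtX.+ˢ≡⊕ _ _) (≡.cong (PtX.cst (Pt.cst a) PtX.⊕_) (PtX.*ˢ≡⊛ t+X (σ F)))))

  ≈mod⇒≡mod : ∀ {F G π} → F ≈ G mod π → F ≡ G mod π
  ≈mod⇒≡mod {F} {G} {π} (h , F≈G+πh) =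
    h , Pt.coef-≈ (trans F≈G+πh (Pt.≡⇒≋ (≡.trans (Pt.+ˢ≡⊕ G (π * h)) (≡.cong (G Pt.⊕_) (Pt.*ˢ≡⊛ π h)))))

  theorem : ∀ 𝔭 d → MonicOfDegree 𝔭 d → ∀ k l → 1 ≤ k → l < k →
            δt l (O2 (pow Rx 𝔭 k)) ≡ RawRing._*_ Rxt (inX (pow Rx 𝔭 (k ∸ l ∸ 1))) (pow Rxt (O2 𝔭) (l +ℕ 1)) mod inT 𝔭
  theorem 𝔭 d (lead , above) (suc k) l _ l<1+k =
    ≡.subst₂ (λ F G → F ≡ G mod inT 𝔭) δₗ≡ product≡
      (≈mod⇒≡mod (≈mod-trans congruence (≈⇒≈mod (*-cong (sym (inX-pow 𝔭 n)) (pow-cong Pt.sealedRing (sym (O2≈Δ 𝔭)) m)))))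
    where
      open Chain Pt.sealedRing using (chain)
      inX-pow = pow-homo Px.commutativeRing Pt.sealedRing Pt.cst-isRingHomomorphismˢ
      P = pow Rx 𝔭 (suc k)
      G = O2 P
      π = inT 𝔭
      n = suc k ∸ l ∸ 1
      m = l +ℕ 1

      uG+πᵏ≈P : u * G + pow rawRing π (suc k) ≈ inX P
      uG+πᵏ≈P = trans (+-cong (*-congˡ (O2≈Δ P)) (sym (inT-pow 𝔭 (suc k)))) (Δ-spec P)

      s₀ : u * coefₓ (σ G) 0 ≈ inX 𝔭 * pow rawRing (inX 𝔭) k mod π
      s₀ = +*≈⇒≈mod (trans (+-congʳ (*-congˡ (coefₓ₀-σ G))) (trans uG+πᵏ≈P (inX-pow 𝔭 (suc k))))

      cancel : ∀ {y y′} → u * y ≈ u * y′ mod π → y ≈ y′ mod π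
      cancel = u-cancel-mod Px.X-nonZeroDivisor {π} {𝔭} (Px.monic-nonZeroDivisor {𝔭} {d} lead above) (Px.coef-≈ (evₓ-inT 𝔭))

      congruence : coefₓ (σ G) l ≈ pow rawRing (inX 𝔭) n * pow rawRing (Δ 𝔭) m mod π
      congruence = chain cancel (Δ-spec 𝔭) (suc k) (coefₓ (σ G)) s₀ (shift-step (suc k) uG+πᵏ≈P) l l<1+k

      δₗ≡ : coefₓ (σ G) l ≡ δt l G
      δₗ≡ = ≡.cong (λ F → coeff Rxt F l) (≡.sym (shift≡σ G))

      product≡ : inX (pow Rx 𝔭 n) * pow rawRing (O2 𝔭) m ≡ RawRing._*_ Rxt (inX (pow Rx 𝔭 n)) (pow Rxt (O2 𝔭) m)
      product≡ = ≡.trans (Pt.*ˢ≡⊛ _ _) (≡.cong (inX (pow Rx 𝔭 n) Pt.⊛_) (Pt.powˢ≡pow (O2 𝔭) m))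

lemma4p10 : ∀ {c ℓ : Level} (F : FiniteField c ℓ) →
    let R = CommutativeRing.rawRing (FiniteField.commutativeRing F)
        open Constructions R
        _*xt_ = RawRing._*_ Rxt
    in (𝔭 : RawRing.Carrier Rx) (d : ℕ) → MonicOfDegree 𝔭 d → Irreducible Rx 𝔭 →
       (k l : ℕ) → 1 ≤ k → l < k →
       δt l (O2 (pow Rx 𝔭 k))
         ≡ inX (pow Rx 𝔭 (k ∸ l ∸ 1)) *xt pow Rxt (O2 𝔭) (l +ℕ 1)
         mod inT 𝔭
lemma4p10 F 𝔭 d monic _ = Bivariate.theorem (FiniteField.commutativeRing F) 𝔭 d monic
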